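{- Let $G$ be a finite non-redundant graph, let $k,l\in\mathbb{Z}_{>0}$ and let $\rho:\{1,\dots,k\}\to VG$, $\sigma:\{1,\dots,l\}\to VG$ be maps with $\bigcup_{j=1}^{l}G_{\sigma(j)}=\bigcup_{i=1}^kG_{\rho(i)}=G$. If $\sum_{i=1}^k\rho(i)=\sum_{j=1}^l\sigma(j)$ in the graph monoid $\mathcal{M}(G)$, then for the spider products $(G_\rho,S_\rho):=\langle\langle (G,k,\rho)\rangle\rangle$ and $(G_\sigma,S_\sigma):=\langle\langle (G,l,\sigma)\rangle\rangle$ the unfolding trees $\mathcal{T}(G_\rho,S_\rho)$ and $\mathcal{T}(G_\sigma,S_\sigma)$ are almost isomorphic.
   Context: A graph is $G=(V,E,o,t)$ with vertex set $V$, edge set $E$, maps $o,t:E\to V$ (origin, terminus); loops and multiple edges allowed. $E_o(v)=\{e:o(e)=v\}$, $E_t(v)=\{e:t(e)=v\}$. A walk is an empty walk $\epsilon_v$ ($O=T=v$) or $e_1\dots e_n$ with $t(e_i)=o(e_{i+1})$, $O=o(e_1)$, $T=t(e_n)$. $G_x$ is the vertex-induced subgraph on vertices reachable from $x$ by a walk. Equivalence relations on $G$: pairs of equivalence relations $\sim_V,\sim_E$ with $e_1\sim_E e_2\Rightarrow o(e_1)\sim_V o(e_2),t(e_1)\sim_V t(e_2)$; non-edge-collapsing if for all $v\sim_V v'$ and each $e$ with $o(e)=v$ there is exactly one $e'$ with $o(e')=v'$ and $e\sim_E e'$; $G$ is non-redundant if the only such relation is trivial. For $k>0$ and $\rho:\{1,\dots,k\}\to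 VG$ with $\bigcup_iG_{\rho(i)}=G$, the spider product $\langle\langle (G,k,\rho)\rangle\rangle$ is the graph obtained from $G$ by adding a new vertex $S$ (its root) and new edges $(S,\rho(i),i)$ from $S$ to $\rho(i)$ for $1\le i\le k$. The unfolding tree $\mathcal{T}(G,S)$ has vertices the walks with origin $S$, edges from $w$ to $we$ whenever $e$ is an edge and $we$ a walk. A tree is a graph in which any two vertices are termini of walks with a common origin, with no nonempty closed walks, and distinct edges have distinct termini. For a subgraph $H$, $G\setminus H$ has edges $EG\setminus EH$ and vertices $VG$ minus those $v$ with $E_o(v),E_t(v)\neq\emptyset$ and $E_o(v)\cup E_t(v)\subseteq EH$. Trees $\mathcal{T}_1,\mathcal{T}_2$ are almost isomorphic if there exist finite subtrees $T_i\le\mathcal{T}_i$ and an isomorphism $\mathcal{T}_1\setminus T_1\to\mathcal{T}_2\setminus T_2$. The graph monoid $\mathcal{M}(G)$ is the commutative monoid generated by $V$ subject to $v=\sum_{e\in E_o(v)}t(e)$ for each $v$ with $E_o(v)\neq\emptyset$. -}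

module Defs where

open import Data.Nat using (ℕ; zero; suc; _+_; _<_)
open import Data.Fin using (Fin; _≟_)
open import Data.List using (List; map; allFin)
open import Data.Nat.ListAction using (sum)
open import Data.List.Membership.Propositional using (_∈_)
open import Data.Product using (Σ; ∃; ∃-syntax; _×_; _,_)
open import Data.Sum using (_⊎_; inj₁; inj₂)
open import Data.Unit using (⊤; tt)
open import Data.Empty using (⊥)
open import Data.Bool using (if_then_else_; _∧_)
open import Relation.Nullary using (¬_)
open import Relation.Nullary.Decidable using (⌊_⌋)
open import Relation.Binary.Core using (Rel)
open import Relation.Binary.Structures using (IsEquivalence)
open import Relation.Binary.PropositionalEquality using (_≡_)

record Graph : Set₁ where
  field
    V : Set
    E : Set
    o : E → V
    t : E → V
open Graph public

record FinGraph : Set where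
  field
    nV : ℕ
    nE : ℕ
    src : Fin nE → Fin nV
    tgt : Fin nE → Fin nV
open FinGraph public

toGraph : FinGraph → Graph
toGraph G = record { V = Fin (nV G) ; E = Fin (nE G) ; o = src G ; t = tgt G }

data Walk (Γ : Graph) : V Γ → V Γ → Set where
  ε   : ∀ {v} → Walk Γ v v
  _∷_ : ∀ {w} (e : E Γ) → Walk Γ (t Γ e) w → Walk Γ (o Γ e) w

-- G_x : the vertex-induced subgraph on the vertices reachable from x.
-- Vertex v lies in G_x iff Reach x v; edge e lies in G_x iff both its
-- endpoints do.
Reach : (Γ : Graph) → V Γ → V Γ → Set
Reach Γ x y = Walk Γ x y

record GraphEquiv (Γ : Graph) : Set₁ where
  field
    _∼V_ : Rel (V Γ) _
    _∼E_ : Rel (E Γ) _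
    isEqV : IsEquivalence _∼V_
    isEqE : IsEquivalence _∼E_
    compat : ∀ e₁ e₂ → e₁ ∼E e₂ → (o Γ e₁ ∼V o Γ e₂) × (t Γ e₁ ∼V t Γ e₂)

NonEdgeCollapsing : (Γ : Graph) → GraphEquiv Γ → Set
NonEdgeCollapsing Γ R =
  ∀ v v' → v ∼V v' → ∀ e → o Γ e ≡ v →
    Σ (E Γ) λ e' → (o Γ e' ≡ v' × e ∼E e')
      × (∀ e'' → o Γ e'' ≡ v' → e ∼E e'' → e'' ≡ e')
  where open GraphEquiv R

Trivial : (Γ : Graph) → GraphEquiv Γ → Set
Trivial Γ R = (∀ v w → v ∼V w → v ≡ w) × (∀ e f → e ∼E f → e ≡ f)
  where open GraphEquiv R

NonRedundant : Graph → Set₁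
NonRedundant Γ = (R : GraphEquiv Γ) → NonEdgeCollapsing Γ R → Trivial Γ R

-- Graph monoid M(G) of a finite graph: the free commutative monoid on
-- VG (= ℕ-valued vectors Fin nV → ℕ) modulo the congruence generated by
--   v = Σ_{e ∈ E_o(v)} t(e)   for every v with E_o(v) ≠ ∅.

Vect : FinGraph → Set
Vect G = Fin (nV G) → ℕ

_⊕_ : ∀ {G} → Vect G → Vect G → Vect G
(x ⊕ y) w = x w + y w

gen : ∀ G → Fin (nV G) → Vect G
gen G v w = if ⌊ v ≟ w ⌋ then 1 else 0

outSum : ∀ G → Fin (nV G) → Vect G
outSum G v w =
  sum (map (λ e → if ⌊ src G e ≟ v ⌋ ∧ ⌊ tgt G e ≟ w ⌋ then 1 else 0)
           (allFin (nE G)))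

data MEq (G : FinGraph) : Vect G → Vect G → Set where
  ≈-ptw   : ∀ {x y} → (∀ w → x w ≡ y w) → MEq G x y
  ≈-sym   : ∀ {x y} → MEq G x y → MEq G y x
  ≈-trans : ∀ {x y z} → MEq G x y → MEq G y z → MEq G x z
  ≈-cong  : ∀ {x y} (z : Vect G) → MEq G x y → MEq G (_⊕_ {G} x z) (_⊕_ {G} y z)
  ≈-rel   : ∀ v → (∃[ e ] src G e ≡ v) → MEq G (gen G v) (outSum G v)

sumMap : ∀ G {k} → (Fin k → Fin (nV G)) → Vect G
sumMap G {k} ρ w = sum (map (λ i → if ⌊ ρ i ≟ w ⌋ then 1 else 0) (allFin k))

Spider : (G : FinGraph) (k : ℕ) → (Fin k → Fin (nV G)) → Graph
Spider G k ρ = record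
  { V = ⊤ ⊎ Fin (nV G)
  ; E = Fin k ⊎ Fin (nE G)
  ; o = λ { (inj₁ i) → inj₁ tt ; (inj₂ e) → inj₂ (src G e) }
  ; t = λ { (inj₁ i) → inj₂ (ρ i) ; (inj₂ e) → inj₂ (tgt G e) }
  }

root : (G : FinGraph) (k : ℕ) (ρ : Fin k → Fin (nV G)) → V (Spider G k ρ)
root G k ρ = inj₁ tt

-- Unfolding tree T(Γ, S): vertices = walks with origin S (recorded by
-- their terminus), edges w → we.

data PathFrom (Γ : Graph) (S : V Γ) : V Γ → Set where
  ε    : PathFrom Γ S S
  _▷_  : ∀ (e : E Γ) → PathFrom Γ S (o Γ e) → PathFrom Γ S (t Γ e)
-- (e ▷ w) denotes the walk w followed by e

Unfolding : (Γ : Graph) → V Γ → Graph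
Unfolding Γ S = record
  { V = Σ (V Γ) (PathFrom Γ S)
  ; E = Σ (E Γ) (λ e → PathFrom Γ S (o Γ e))
  ; o = λ { (e , w) → (o Γ e , w) }
  ; t = λ { (e , w) → (t Γ e , e ▷ w) }
  }

record Subgraph (Γ : Graph) : Set₁ where
  field
    VP : V Γ → Set
    EP : E Γ → Set
    closed : ∀ e → EP e → VP (o Γ e) × VP (t Γ e)
open Subgraph public

FiniteSub : ∀ {Γ} → Subgraph Γ → Set
FiniteSub {Γ} H =
  (∃[ vs ] ∀ (v : V Γ) → VP H v → v ∈ vs) ×
  (∃[ es ] ∀ (e : E Γ) → EP H e → e ∈ es)

data SubWalk {Γ : Graph} (H : Subgraph Γ) : V Γ → V Γ → Set where
  ε   : ∀ {v} → SubWalk H v v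
  _∷_ : ∀ {w} (e : E Γ) → EP H e → SubWalk H (t Γ e) w → SubWalk H (o Γ e) w

IsTreeSub : ∀ {Γ} → Subgraph Γ → Set
IsTreeSub {Γ} H =
  (∀ x y → VP H x → VP H y →
     ∃[ z ] (VP H z × SubWalk H z x × SubWalk H z y)) ×
  (∀ e → EP H e → SubWalk H (t Γ e) (o Γ e) → ⊥) ×
  (∀ e f → EP H e → EP H f → t Γ e ≡ t Γ f → e ≡ f)

Removed : ∀ {Γ} → Subgraph Γ → V Γ → Set
Removed {Γ} H v =
  (∃[ e ] o Γ e ≡ v) × (∃[ e ] t Γ e ≡ v) ×
  (∀ e → (o Γ e ≡ v ⊎ t Γ e ≡ v) → EP H e)

RemV : ∀ {Γ} → Subgraph Γ → V Γ → Set
RemV H v = ¬ Removed H v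

RemE : ∀ {Γ} → Subgraph Γ → E Γ → Set
RemE H e = ¬ EP H e

record IsoMinus {Γ₁ Γ₂ : Graph} (H₁ : Subgraph Γ₁) (H₂ : Subgraph Γ₂) : Set where
  field
    fV : (v : V Γ₁) → RemV H₁ v → V Γ₂
    gV : (v : V Γ₂) → RemV H₂ v → V Γ₁
    fE : (e : E Γ₁) → RemE H₁ e → E Γ₂
    gE : (e : E Γ₂) → RemE H₂ e → E Γ₁
    fV-rem : ∀ v p → RemV H₂ (fV v p)
    gV-rem : ∀ v p → RemV H₁ (gV v p)
    fE-rem : ∀ e p → RemE H₂ (fE e p)
    gE-rem : ∀ e p → RemE H₁ (gE e p)
    gfV : ∀ v p → gV (fV v p) (fV-rem v p) ≡ v
    fgV : ∀ v p → fV (gV v p) (gV-rem v p) ≡ v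
    gfE : ∀ e p → gE (fE e p) (fE-rem e p) ≡ e
    fgE : ∀ e p → fE (gE e p) (gE-rem e p) ≡ e
    o-comm : ∀ e (p : RemE H₁ e) (q : RemV H₁ (o Γ₁ e)) →
               o Γ₂ (fE e p) ≡ fV (o Γ₁ e) q
    t-comm : ∀ e (p : RemE H₁ e) (q : RemV H₁ (t Γ₁ e)) →
               t Γ₂ (fE e p) ≡ fV (t Γ₁ e) q

AlmostIsomorphic : Graph → Graph → Set₁
AlmostIsomorphic Γ₁ Γ₂ =
  Σ (Subgraph Γ₁) λ T₁ → Σ (Subgraph Γ₂) λ T₂ →
    (FiniteSub T₁ × IsTreeSub T₁) × (FiniteSub T₂ × IsTreeSub T₂) ×
    IsoMinus T₁ T₂

CoversG : (G : FinGraph) {k : ℕ} → (Fin k → Fin (nV G)) → Set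
CoversG G {k} ρ =
  (∀ v → ∃[ i ] Reach (toGraph G) (ρ i) v) ×
  (∀ e → ∃[ i ] (Reach (toGraph G) (ρ i) (src G e) × Reach (toGraph G) (ρ i) (tgt G e)))

-- Read left to right, the relations v = Σ_{e ∈ E_o(v)} t(e) form a rewriting system on vectors
-- that is confluent (rewrites at distinct vertices commute), so Σρ = Σσ in M(G) means that both
-- rewrite to a common vector z. A rewriting sequence from Σρ is mirrored by a finite subtree T of
-- the unfolding tree of ⟨⟨G,k,ρ⟩⟩ containing its root: rewriting v adds all children of a leaf
-- at v. The leaves of T then count z, and removing T leaves the root together with one copy of
-- the unfolding tree of G at b for each leaf at b. The same holds for σ, so the complements agree.
module Submission where

open import Defs

open import Axiom.UniquenessOfIdentityProofs using (module Decidable⇒UIP)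
open import Data.Bool using (Bool; true; false; if_then_else_; _∧_)
open import Data.Bool.Properties using (¬-not)
open import Data.Empty using (⊥; ⊥-elim)
import Data.Empty.Irrelevant as Irr
open import Data.Fin using (Fin; zero; suc; _≟_)
open import Data.Fin.Properties using (suc-injective)
open import Data.Irrelevant using (Irrelevant; [_])
open import Data.List using (List; []; _∷_; _++_; map; concatMap; allFin)
open import Data.List.Extrema.Nat using (max; xs≤max)
open import Data.List.Membership.Propositional using (_∈_; lose)
open import Data.List.Membership.Propositional.Properties
  using (∈-∃++; ∈-map⁺; ∈-concatMap⁺; ∈-++⁺ˡ; ∈-++⁺ʳ; ∈-allFin)
open import Data.List.Properties using (map-tabulate)
open import Data.List.Relation.Binary.BagAndSetEquality using (↭⇒∼bag)
open import Data.List.Relation.Binary.Permutation.Propositional using (_↭_; ↭-refl; ↭-prep; ↭-sym; ↭-trans)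
open import Data.List.Relation.Binary.Permutation.Propositional.Properties using (shift)
import Data.List.Relation.Unary.All as All
open import Data.List.Relation.Unary.Any using (here; there)
open import Data.List.Relation.Unary.Any.Properties using (++↔)
open import Data.Maybe using (Maybe; just; nothing)
open import Data.Maybe.Properties using (just-injective)
open import Data.Nat using (ℕ; zero; suc; _+_; _∸_; _≤_; _<_; z≤n; s≤s)
open import Data.Nat.ListAction using (sum)
open import Data.Nat.Properties
  using (≤-refl; ≤-trans; n≤1+n; m≤n⇒m≤1+n; 1+n≰n; +-assoc; +-comm; +-identityʳ; +-cancelˡ-≡; m+[n∸m]≡n;
         +-commutativeSemigroup)
open import Algebra.Properties.CommutativeSemigroup +-commutativeSemigroup using (x∙yz≈y∙xz)
open import Data.Product using (Σ; ∃; _×_; _,_; proj₁; proj₂)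
import Data.Product.Function.Dependent.Propositional as Σ
open import Data.Sum using (_⊎_; inj₁; inj₂)
import Data.Sum as Sum
open import Data.Sum.Function.Propositional using (_⊎-cong_)
open import Data.Sum.Properties using (≡-dec)
open import Data.Unit using (⊤; tt)
import Data.Unit.Properties as Unit
open import Function using (_∘_; id)
open import Function.Bundles using (_↔_; Inverse; mk↔ₛ′)
open import Function.Properties.Inverse using (↔-refl; ↔-sym; ↔-trans)
open import Function.Related.TypeIsomorphisms using (Σ-assoc)
open import Relation.Binary.Definitions using (DecidableEquality)
open import Relation.Binary.PropositionalEquality
open import Relation.Nullary using (¬_; Dec; yes; no)
open import Relation.Nullary.Decidable using (⌊_⌋)

record _≅_ (Γ Δ : Graph) : Set where
  field
    vertices : V Γ ↔ V Δ
    edges    : E Γ ↔ E Δ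
  open Inverse vertices public using () renaming (to to vertex; from to vertex⁻¹)
  open Inverse edges public using () renaming (to to edge; from to edge⁻¹)
  field
    o-comm : ∀ e → o Δ (edge e) ≡ vertex (o Γ e)
    t-comm : ∀ e → t Δ (edge e) ≡ vertex (t Γ e)

infix 4 _≅_

≅-sym : ∀ {Γ Δ} → Γ ≅ Δ → Δ ≅ Γ
≅-sym {Γ} {Δ} φ = record
  { vertices = ↔-sym vertices
  ; edges    = ↔-sym edges
  ; o-comm   = comm o o-comm
  ; t-comm   = comm t t-comm
  }
  where
  open _≅_ φ
  comm : (end : ∀ Θ → E Θ → V Θ) → (∀ e → end Δ (edge e) ≡ vertex (end Γ e)) →
         ∀ e → end Γ (edge⁻¹ e) ≡ vertex⁻¹ (end Δ e)
  comm end end-comm e = begin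
    end Γ (edge⁻¹ e)                      ≡⟨ Inverse.strictlyInverseʳ vertices _ ⟨
    vertex⁻¹ (vertex (end Γ (edge⁻¹ e)))  ≡⟨ cong vertex⁻¹ (end-comm (edge⁻¹ e)) ⟨
    vertex⁻¹ (end Δ (edge (edge⁻¹ e)))    ≡⟨ cong (vertex⁻¹ ∘ end Δ) (Inverse.strictlyInverseˡ edges e) ⟩
    vertex⁻¹ (end Δ e)                    ∎
    where open ≡-Reasoning

≅-trans : ∀ {Γ Δ Θ} → Γ ≅ Δ → Δ ≅ Θ → Γ ≅ Θ
≅-trans φ ψ = record
  { vertices = ↔-trans (vertices φ) (vertices ψ)
  ; edges    = ↔-trans (edges φ) (edges ψ)
  ; o-comm   = λ e → trans (o-comm ψ _) (cong (vertex ψ) (o-comm φ e))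
  ; t-comm   = λ e → trans (t-comm ψ _) (cong (vertex ψ) (t-comm φ e))
  }
  where open _≅_

point : Graph
point = record { V = ⊤ ; E = ⊥ ; o = λ () ; t = λ () }

_⊞_ : Graph → Graph → Graph
Γ ⊞ Δ = record
  { V = V Γ ⊎ V Δ
  ; E = E Γ ⊎ E Δ
  ; o = Sum.map (o Γ) (o Δ)
  ; t = Sum.map (t Γ) (t Δ)
  }

Σᴳ : (I : Set) → (I → Graph) → Graph
Σᴳ I F = record
  { V = Σ I (V ∘ F)
  ; E = Σ I (E ∘ F)
  ; o = λ (i , e) → i , o (F i) e
  ; t = λ (i , e) → i , t (F i) e
  }

⊞-congʳ : ∀ {Γ Δ Δ′} → Δ ≅ Δ′ → Γ ⊞ Δ ≅ Γ ⊞ Δ′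
⊞-congʳ φ = record
  { vertices = ↔-refl ⊎-cong vertices
  ; edges    = ↔-refl ⊎-cong edges
  ; o-comm   = λ { (inj₁ e) → refl ; (inj₂ e) → cong inj₂ (o-comm e) }
  ; t-comm   = λ { (inj₁ e) → refl ; (inj₂ e) → cong inj₂ (t-comm e) }
  }
  where open _≅_ φ

Σᴳ-cong : ∀ {I} {F F′ : I → Graph} → (∀ i → F i ≅ F′ i) → Σᴳ I F ≅ Σᴳ I F′
Σᴳ-cong φ = record
  { vertices = Σ.congˡ (vertices (φ _))
  ; edges    = Σ.congˡ (edges (φ _))
  ; o-comm   = λ (i , e) → cong (i ,_) (o-comm (φ i) e)
  ; t-comm   = λ (i , e) → cong (i ,_) (t-comm (φ i) e)
  }
  where open _≅_

Σᴳ-assoc : ∀ {I} {J : I → Set} (F : (i : I) → J i → Graph) →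
           Σᴳ I (λ i → Σᴳ (J i) (F i)) ≅ Σᴳ (Σ I J) (λ (i , j) → F i j)
Σᴳ-assoc {I} {J} F = record
  { vertices = reassoc
  ; edges    = reassoc
  ; o-comm   = λ _ → refl
  ; t-comm   = λ _ → refl
  }
  where
  reassoc : ∀ {X : (i : I) → J i → Set} → Σ I (λ i → Σ (J i) (X i)) ↔ Σ (Σ I J) (λ (i , j) → X i j)
  reassoc = mk↔ₛ′ (λ (i , j , x) → (i , j) , x) (λ ((i , j) , x) → i , j , x) (λ _ → refl) (λ _ → refl)

Σᴳ-swap : ∀ {I A : Set} {P : I → A → Set} (F : A → Graph) →
          Σᴳ (Σ I (λ i → Σ A (P i))) (F ∘ proj₁ ∘ proj₂) ≅ Σᴳ (Σ A (λ a → Σ I (λ i → P i a))) (F ∘ proj₁)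
Σᴳ-swap {I} {A} {P} F = record
  { vertices = swap
  ; edges    = swap
  ; o-comm   = λ _ → refl
  ; t-comm   = λ _ → refl
  }
  where
  swap : ∀ {X : A → Set} →
         Σ (Σ I (λ i → Σ A (P i))) (X ∘ proj₁ ∘ proj₂) ↔ Σ (Σ A (λ a → Σ I (λ i → P i a))) (X ∘ proj₁)
  swap = mk↔ₛ′ (λ ((i , a , p) , x) → (a , i , p) , x) (λ ((a , i , p) , x) → (i , a , p) , x)
               (λ _ → refl) (λ _ → refl)

Σᴳ-reindex : ∀ {A : Set} {P Q : A → Set} (F : A → Graph) → (∀ a → P a ↔ Q a) →
             Σᴳ (Σ A P) (F ∘ proj₁) ≅ Σᴳ (Σ A Q) (F ∘ proj₁)
Σᴳ-reindex {A} {P} {Q} F β = record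
  { vertices = reindex
  ; edges    = reindex
  ; o-comm   = λ _ → refl
  ; t-comm   = λ _ → refl
  }
  where
  reindex : ∀ {X : A → Set} → Σ (Σ A P) (X ∘ proj₁) ↔ Σ (Σ A Q) (X ∘ proj₁)
  reindex = mk↔ₛ′ (λ ((a , p) , x) → (a , Inverse.to (β a) p) , x)
                  (λ ((a , q) , x) → (a , Inverse.from (β a) q) , x)
                  (λ ((a , q) , x) → cong (λ q → (a , q) , x) (Inverse.strictlyInverseˡ (β a) q))
                  (λ ((a , p) , x) → cong (λ p → (a , p) , x) (Inverse.strictlyInverseʳ (β a) p))

module _ {A : Set} where

  concatFin : ∀ n → (Fin n → List A) → List A
  concatFin zero    h = []
  concatFin (suc n) h = h zero ++ concatFin n (h ∘ suc)

  ∈-concatFin↔ : ∀ {b : A} n (h : Fin n → List A) → b ∈ concatFin n h ↔ Σ (Fin n) (λ i → b ∈ h i)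
  ∈-concatFin↔ zero    h = mk↔ₛ′ (λ ()) (λ ()) (λ ()) (λ ())
  ∈-concatFin↔ (suc n) h = ↔-trans (↔-sym ++↔) (↔-trans (↔-refl ⊎-cong ∈-concatFin↔ n (h ∘ suc)) split)
    where
    split : ∀ {P : Fin (suc n) → Set} → (P zero ⊎ Σ (Fin n) (P ∘ suc)) ↔ Σ (Fin (suc n)) P
    split = mk↔ₛ′ Sum.[ (zero ,_) , (λ (i , p) → suc i , p) ]
                  (λ { (zero , p) → inj₁ p ; (suc i , p) → inj₂ (i , p) })
                  (λ { (zero , p) → refl ; (suc i , p) → refl })
                  (λ { (inj₁ p) → refl ; (inj₂ (i , p)) → refl })

  guard : ∀ {P : Set} → Dec P → List A → List A
  guard (yes _) xs = xs
  guard (no _)  xs = []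

  guard-yes : ∀ {P : Set} → P → (d : Dec P) (xs : List A) → guard d xs ≡ xs
  guard-yes p (yes _) xs = refl
  guard-yes p (no ¬p) xs = ⊥-elim (¬p p)

  ∈-guard↔ : ∀ {b : A} {P : Set} → (∀ (p q : P) → p ≡ q) → (d : Dec P) (xs : List A) →
             b ∈ guard d xs ↔ (P × b ∈ xs)
  ∈-guard↔ irr (yes p) xs = mk↔ₛ′ (p ,_) proj₂ (λ (p′ , m) → cong (_, m) (irr p p′)) (λ _ → refl)
  ∈-guard↔ irr (no ¬p) xs = mk↔ₛ′ (λ ()) (λ (p , _) → ⊥-elim (¬p p)) (λ (p , _) → ⊥-elim (¬p p)) (λ ())

true≢false : true ≢ false
true≢false ()

module Expansions (Γ : Graph) where

  snoc : ∀ {x} (e : E Γ) → Walk Γ x (o Γ e) → Walk Γ x (t Γ e)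
  snoc e ε        = e ∷ ε
  snoc e (e′ ∷ w) = e′ ∷ snoc e w

  -- The unfolding tree at x, with walks read from x rather than from their last edge.
  Cone : V Γ → Graph
  Cone x = record
    { V = Σ (V Γ) (Walk Γ x)
    ; E = Σ (E Γ) (Walk Γ x ∘ o Γ)
    ; o = λ (e , w) → o Γ e , w
    ; t = λ (e , w) → t Γ e , snoc e w
    }

  HasOutEdge : V Γ → Set
  HasOutEdge x = ∃ λ e → o Γ e ≡ x

  -- A finite subtree of the cone at x, described by its interior vertices. Interior vertices
  -- must have an out-edge, as a sink is never Removed. Only the children f e with o Γ e ≡ x matter.
  data Expansion : V Γ → Set where
    leaf : ∀ {x} → Expansion x
    node : ∀ {x} → HasOutEdge x → ((e : E Γ) → Expansion (t Γ e)) → Expansion x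

  interior : ∀ {x y} → Expansion x → Walk Γ x y → Bool
  interior leaf       w       = false
  interior (node _ f) ε       = true
  interior (node _ f) (e ∷ w) = interior (f e) w

  removed : ∀ {x y} → Expansion x → Walk Γ x y → Bool
  removed ex ε       = false
  removed ex (e ∷ w) = interior ex (e ∷ w)

  interior-snoc : ∀ {x} (ex : Expansion x) e (w : Walk Γ x (o Γ e)) →
                  interior ex w ≡ false → interior ex (snoc e w) ≡ false
  interior-snoc leaf       e w        _  = refl
  interior-snoc (node _ f) e (e′ ∷ w) ¬i = interior-snoc (f e′) e w ¬i

  ¬interior⇒¬removed : ∀ {x y} (ex : Expansion x) (w : Walk Γ x y) →
                       interior ex w ≡ false → removed ex w ≡ false
  ¬interior⇒¬removed ex ε       _  = refl
  ¬interior⇒¬removed ex (e ∷ w) ¬i = ¬i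

  interior-prefix : ∀ {x} (ex : Expansion x) e (w : Walk Γ x (o Γ e)) →
                    interior ex (snoc e w) ≡ true → interior ex w ≡ true
  interior-prefix ex e w i with interior ex w in eq
  ... | true  = refl
  ... | false = ⊥-elim (true≢false (trans (sym i) (interior-snoc ex e w eq)))

  interior⇒hasOutEdge : ∀ {x y} (ex : Expansion x) (w : Walk Γ x y) → interior ex w ≡ true → HasOutEdge y
  interior⇒hasOutEdge (node n f) ε       _ = n
  interior⇒hasOutEdge (node n f) (e ∷ w) i = interior⇒hasOutEdge (f e) w i

  removed-snoc : ∀ {x} (ex : Expansion x) e (w : Walk Γ x (o Γ e)) → removed ex (snoc e w) ≡ interior ex (snoc e w)
  removed-snoc ex e ε        = refl
  removed-snoc ex e (e′ ∷ w) = refl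

  Beyond : ∀ {x} → Expansion x → Graph
  Beyond {x} ex = record
    { V = Σ (V Γ) (λ y → Σ (Walk Γ x y) (λ w → Irrelevant (interior ex w ≡ false)))
    ; E = Σ (E Γ) (λ e → Σ (Walk Γ x (o Γ e)) (λ w → Irrelevant (interior ex w ≡ false)))
    ; o = λ (e , w , ¬i) → o Γ e , w , ¬i
    ; t = λ (e , w , [ ¬i ]) → t Γ e , snoc e w , [ interior-snoc ex e w ¬i ]
    }

  -- Cone x ∖ ex; the root x is never Removed, having no in-edge.
  ConeMinus : ∀ {x} → Expansion x → Graph
  ConeMinus {x} ex = record
    { V = Σ (V Γ) (λ y → Σ (Walk Γ x y) (λ w → Irrelevant (removed ex w ≡ false)))
    ; E = E (Beyond ex)
    ; o = λ (e , w , [ ¬i ]) → o Γ e , w , [ ¬interior⇒¬removed ex w ¬i ]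
    ; t = λ (e , w , [ ¬i ]) → t Γ e , snoc e w , [ ¬interior⇒¬removed ex (snoc e w) (interior-snoc ex e w ¬i) ]
    }

  beyond-leaf≅cone : ∀ {x} → Beyond (leaf {x}) ≅ Cone x
  beyond-leaf≅cone = record
    { vertices = mk↔ₛ′ (λ (y , w , _) → y , w) (λ (y , w) → y , w , [ refl ]) (λ _ → refl) (λ _ → refl)
    ; edges    = mk↔ₛ′ (λ (e , w , _) → e , w) (λ (e , w) → e , w , [ refl ]) (λ _ → refl) (λ _ → refl)
    ; o-comm   = λ _ → refl
    ; t-comm   = λ _ → refl
    }

  module _ {x} (n : HasOutEdge x) (f : (e : E Γ) → Expansion (t Γ e)) where

    coneMinus≅point⊞beyond : ConeMinus (node n f) ≅ point ⊞ Beyond (node n f)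
    coneMinus≅point⊞beyond = record
      { vertices = mk↔ₛ′ to from to∘from (λ { (y , ε , _) → refl ; (y , e ∷ w , _) → refl })
      ; edges    = mk↔ₛ′ inj₂ (λ { (inj₁ ()) ; (inj₂ e) → e }) (λ { (inj₁ ()) ; (inj₂ e) → refl }) (λ _ → refl)
      ; o-comm   = λ { (e , ε , [ i ]) → Irr.⊥-elim (true≢false i) ; (e , e′ ∷ w , _) → refl }
      ; t-comm   = λ { (e , ε , _) → refl ; (e , e′ ∷ w , _) → refl }
      }
      where
      to : V (ConeMinus (node n f)) → V (point ⊞ Beyond (node n f))
      to (y , ε , _)     = inj₁ tt
      to (y , e ∷ w , ¬r) = inj₂ (y , e ∷ w , ¬r)
      from : V (point ⊞ Beyond (node n f)) → V (ConeMinus (node n f))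
      from (inj₁ tt)              = x , ε , [ refl ]
      from (inj₂ (y , w , [ ¬i ])) = y , w , [ ¬interior⇒¬removed (node n f) w ¬i ]
      to∘from : ∀ v → to (from v) ≡ v
      to∘from (inj₁ tt)               = refl
      to∘from (inj₂ (y , ε , [ i ]))   = Irr.⊥-elim (true≢false i)
      to∘from (inj₂ (y , e ∷ w , _))   = refl

    Children : Graph
    Children = Σᴳ (Σ (E Γ) (λ e → o Γ e ≡ x)) (λ (e , _) → Beyond (f e))

    beyond-node≅children : Beyond (node n f) ≅ Children
    beyond-node≅children = record
      { vertices = mk↔ₛ′ (λ { (y , ε , [ i ]) → Irr.⊥-elim (true≢false i)
                            ; (y , e ∷ w , ¬i) → (e , refl) , y , w , ¬i })
                         (λ { ((e , refl) , y , w , ¬i) → y , e ∷ w , ¬i })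
                         (λ { ((e , refl) , _) → refl })
                         (λ { (y , ε , [ i ]) → Irr.⊥-elim (true≢false i) ; (y , e ∷ w , _) → refl })
      ; edges    = mk↔ₛ′ (λ { (e′ , ε , [ i ]) → Irr.⊥-elim (true≢false i)
                            ; (e′ , e ∷ w , ¬i) → (e , refl) , e′ , w , ¬i })
                         (λ { ((e , refl) , e′ , w , ¬i) → e′ , e ∷ w , ¬i })
                         (λ { ((e , refl) , _) → refl })
                         (λ { (e′ , ε , [ i ]) → Irr.⊥-elim (true≢false i) ; (e′ , e ∷ w , _) → refl })
      ; o-comm   = λ { (e′ , ε , [ i ]) → Irr.⊥-elim (true≢false i) ; (e′ , e ∷ w , _) → refl }
      ; t-comm   = λ { (e′ , ε , [ i ]) → Irr.⊥-elim (true≢false i) ; (e′ , e ∷ w , _) → refl }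
      }

module Frontier (G : FinGraph) where
  open Expansions (toGraph G) public

  frontier : ∀ {a} → Expansion a → List (Fin (nV G))
  frontier {a} leaf       = a ∷ []
  frontier {a} (node _ f) = concatFin (nE G) (λ e → guard (src G e ≟ a) (frontier (f e)))

  frontiers : ∀ {k} {ρ : Fin k → Fin (nV G)} → ((i : Fin k) → Expansion (ρ i)) → List (Fin (nV G))
  frontiers {k} exs = concatFin k (frontier ∘ exs)

  -- One cone for each occurrence of b in L, occurrences being the proofs of b ∈ L.
  Forest : List (Fin (nV G)) → Graph
  Forest L = Σᴳ (Σ (Fin (nV G)) (_∈ L)) (Cone ∘ proj₁)

  cone≅forest-singleton : ∀ {a} → Cone a ≅ Forest (a ∷ [])
  cone≅forest-singleton {a} = record
    { vertices = singleton
    ; edges    = singleton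
    ; o-comm   = λ _ → refl
    ; t-comm   = λ _ → refl
    }
    where
    singleton : ∀ {X : Fin (nV G) → Set} → X a ↔ Σ (Σ (Fin (nV G)) (_∈ a ∷ [])) (X ∘ proj₁)
    singleton = mk↔ₛ′ (λ x → (a , here refl) , x) (λ { ((_ , here refl) , x) → x })
                      (λ { ((_ , here refl) , x) → refl }) (λ _ → refl)

  ∈-frontier-node↔ : ∀ {a b} (n : HasOutEdge a) f →
                     Σ (Σ (Fin (nE G)) (λ e → src G e ≡ a)) (λ (e , _) → b ∈ frontier (f e)) ↔
                     b ∈ frontier (node n f)
  ∈-frontier-node↔ {a} n f =
    ↔-trans Σ-assoc
      (↔-trans (Σ.congˡ (↔-sym (∈-guard↔ (Decidable⇒UIP.≡-irrelevant _≟_) (src G _ ≟ a) (frontier (f _)))))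
               (↔-sym (∈-concatFin↔ (nE G) _)))

  Σᴳ-forest≅forest : ∀ {I} (L : I → List (Fin (nV G))) {M} →
                     (∀ b → Σ I (λ i → b ∈ L i) ↔ b ∈ M) → Σᴳ I (Forest ∘ L) ≅ Forest M
  Σᴳ-forest≅forest L β =
    ≅-trans (Σᴳ-assoc (λ _ (b , _) → Cone b))
    (≅-trans (Σᴳ-swap Cone)
             (Σᴳ-reindex Cone β))

  ↭⇒forest≅ : ∀ {L₁ L₂} → L₁ ↭ L₂ → Forest L₁ ≅ Forest L₂
  ↭⇒forest≅ L₁↭L₂ = Σᴳ-reindex Cone (λ _ → ↭⇒∼bag L₁↭L₂)

  beyond≅forest : ∀ {a} (ex : Expansion a) → Beyond ex ≅ Forest (frontier ex)
  beyond≅forest leaf       = ≅-trans beyond-leaf≅cone cone≅forest-singleton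
  beyond≅forest (node n f) =
    ≅-trans (beyond-node≅children n f)
    (≅-trans (Σᴳ-cong (λ (e , _) → beyond≅forest (f e)))
             (Σᴳ-forest≅forest _ (λ _ → ∈-frontier-node↔ n f)))

module SpiderCones (G : FinGraph) {k : ℕ} (ρ : Fin k → Fin (nV G)) where
  private
    Sp = Spider G k ρ
  module S = Expansions Sp
  open Frontier G

  liftWalk : ∀ {a b} → Walk (toGraph G) a b → Walk Sp (inj₂ a) (inj₂ b)
  liftWalk ε       = ε
  liftWalk (e ∷ w) = inj₂ e ∷ liftWalk w

  lowerWalk : ∀ {x a b} → Walk Sp x (inj₂ b) → x ≡ inj₂ a → Walk (toGraph G) a b
  lowerWalk ε            refl = ε
  lowerWalk (inj₁ _ ∷ w) ()
  lowerWalk (inj₂ e ∷ w) refl = e ∷ lowerWalk w refl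

  root-unreachable : ∀ {x a} → Walk Sp x (inj₁ tt) → x ≢ inj₂ a
  root-unreachable ε            ()
  root-unreachable (inj₁ _ ∷ w) ()
  root-unreachable (inj₂ e ∷ w) refl = root-unreachable w refl

  liftWalk∘lowerWalk : ∀ {x a b} (w : Walk Sp x (inj₂ b)) (p : x ≡ inj₂ a) →
                       liftWalk (lowerWalk w p) ≡ subst (λ x → Walk Sp x (inj₂ b)) p w
  liftWalk∘lowerWalk ε            refl = refl
  liftWalk∘lowerWalk (inj₁ _ ∷ w) ()
  liftWalk∘lowerWalk (inj₂ e ∷ w) refl = cong (inj₂ e ∷_) (liftWalk∘lowerWalk w refl)

  lowerWalk∘liftWalk : ∀ {a b} (w : Walk (toGraph G) a b) → lowerWalk (liftWalk w) refl ≡ w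
  lowerWalk∘liftWalk ε       = refl
  lowerWalk∘liftWalk (e ∷ w) = cong (e ∷_) (lowerWalk∘liftWalk w)

  lowerWalk-snoc : ∀ {x a} e (w : Walk Sp x (inj₂ (src G e))) (p : x ≡ inj₂ a) →
                   lowerWalk (S.snoc (inj₂ e) w) p ≡ snoc e (lowerWalk w p)
  lowerWalk-snoc e ε             refl = refl
  lowerWalk-snoc e (inj₁ _ ∷ w)  ()
  lowerWalk-snoc e (inj₂ e′ ∷ w) refl = cong (e′ ∷_) (lowerWalk-snoc e w refl)

  spiderCone≅cone : ∀ {a} → S.Cone (inj₂ a) ≅ Cone a
  spiderCone≅cone = record
    { vertices = mk↔ₛ′ (λ { (inj₁ _ , w) → ⊥-elim (root-unreachable w refl)
                          ; (inj₂ b , w) → b , lowerWalk w refl })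
                       (λ (b , w) → inj₂ b , liftWalk w)
                       (λ (b , w) → cong (b ,_) (lowerWalk∘liftWalk w))
                       (λ { (inj₁ _ , w) → ⊥-elim (root-unreachable w refl)
                          ; (inj₂ b , w) → cong (inj₂ b ,_) (liftWalk∘lowerWalk w refl) })
    ; edges    = mk↔ₛ′ (λ { (inj₁ _ , w) → ⊥-elim (root-unreachable w refl)
                          ; (inj₂ e , w) → e , lowerWalk w refl })
                       (λ (e , w) → inj₂ e , liftWalk w)
                       (λ (e , w) → cong (e ,_) (lowerWalk∘liftWalk w))
                       (λ { (inj₁ _ , w) → ⊥-elim (root-unreachable w refl)
                          ; (inj₂ e , w) → cong (inj₂ e ,_) (liftWalk∘lowerWalk w refl) })
    ; o-comm   = λ { (inj₁ _ , w) → ⊥-elim (root-unreachable w refl) ; (inj₂ e , w) → refl }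
    ; t-comm   = λ { (inj₁ _ , w) → ⊥-elim (root-unreachable w refl)
                   ; (inj₂ e , w) → cong (tgt G e ,_) (sym (lowerWalk-snoc e w refl)) }
    }

  liftExpansion : ∀ {a} → Expansion a → S.Expansion (inj₂ a)
  liftChildren : ((e : Fin (nE G)) → Expansion (tgt G e)) → (e : E Sp) → S.Expansion (t Sp e)
  liftExpansion leaf             = S.leaf
  liftExpansion (node (e , p) f) = S.node (inj₂ e , cong inj₂ p) (liftChildren f)
  liftChildren f (inj₁ _) = S.leaf
  liftChildren f (inj₂ e) = liftExpansion (f e)

  Σᴳ-outEdges-inj₂≅ : ∀ {a} (F : Σ (E Sp) (λ e → o Sp e ≡ inj₂ a) → Graph) →
    Σᴳ (Σ (E Sp) (λ e → o Sp e ≡ inj₂ a)) F ≅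
    Σᴳ (Σ (Fin (nE G)) (λ e → src G e ≡ a)) (λ (e , p) → F (inj₂ e , cong inj₂ p))
  Σᴳ-outEdges-inj₂≅ {a} F = record
    { vertices = reindex {V}
    ; edges    = reindex {E}
    ; o-comm   = λ { ((inj₂ e , refl) , _) → refl }
    ; t-comm   = λ { ((inj₂ e , refl) , _) → refl }
    }
    where
    reindex : ∀ {X : Graph → Set} →
              Σ (Σ (E Sp) (λ e → o Sp e ≡ inj₂ a)) (X ∘ F) ↔
              Σ (Σ (Fin (nE G)) (λ e → src G e ≡ a)) (λ (e , p) → X (F (inj₂ e , cong inj₂ p)))
    reindex = mk↔ₛ′ (λ { ((inj₂ e , refl) , v) → (e , refl) , v })
                    (λ { ((e , refl) , v) → (inj₂ e , refl) , v })
                    (λ { ((e , refl) , v) → refl })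
                    (λ { ((inj₂ e , refl) , v) → refl })

  beyond-lift≅beyond : ∀ {a} (ex : Expansion a) → S.Beyond (liftExpansion ex) ≅ Beyond ex
  beyond-lift≅beyond leaf                =
    ≅-trans S.beyond-leaf≅cone (≅-trans spiderCone≅cone (≅-sym beyond-leaf≅cone))
  beyond-lift≅beyond (node (e , refl) f) =
    ≅-trans (S.beyond-node≅children _ (liftChildren f))
    (≅-trans (Σᴳ-outEdges-inj₂≅ _)
    (≅-trans (Σᴳ-cong (λ (e , _) → beyond-lift≅beyond (f e)))
             (≅-sym (beyond-node≅children _ f))))

  rootChildren : ((i : Fin k) → Expansion (ρ i)) → (e : E Sp) → S.Expansion (t Sp e)
  rootChildren exs (inj₁ i) = liftExpansion (exs i)
  rootChildren exs (inj₂ e) = S.leaf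

  -- i₀ only witnesses that the root has an out-edge.
  rootExpansion : Fin k → ((i : Fin k) → Expansion (ρ i)) → S.Expansion (inj₁ tt)
  rootExpansion i₀ exs = S.node (inj₁ i₀ , refl) (rootChildren exs)

  Σᴳ-outEdges-root≅ : (F : Σ (E Sp) (λ e → o Sp e ≡ inj₁ tt) → Graph) →
    Σᴳ (Σ (E Sp) (λ e → o Sp e ≡ inj₁ tt)) F ≅ Σᴳ (Fin k) (λ i → F (inj₁ i , refl))
  Σᴳ-outEdges-root≅ F = record
    { vertices = reindex {V}
    ; edges    = reindex {E}
    ; o-comm   = λ { ((inj₁ i , refl) , _) → refl }
    ; t-comm   = λ { ((inj₁ i , refl) , _) → refl }
    }
    where
    reindex : ∀ {X : Graph → Set} →
              Σ (Σ (E Sp) (λ e → o Sp e ≡ inj₁ tt)) (X ∘ F) ↔ Σ (Fin k) (λ i → X (F (inj₁ i , refl)))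
    reindex = mk↔ₛ′ (λ { ((inj₁ i , refl) , v) → i , v })
                    (λ (i , v) → (inj₁ i , refl) , v)
                    (λ _ → refl)
                    (λ { ((inj₁ i , refl) , v) → refl })

  coneMinus-root≅point⊞forest : ∀ i₀ exs → S.ConeMinus (rootExpansion i₀ exs) ≅ point ⊞ Forest (frontiers exs)
  coneMinus-root≅point⊞forest i₀ exs =
    ≅-trans (S.coneMinus≅point⊞beyond _ _)
    (⊞-congʳ
      (≅-trans (S.beyond-node≅children _ _)
      (≅-trans (Σᴳ-outEdges-root≅ _)
      (≅-trans (Σᴳ-cong (λ i → ≅-trans (beyond-lift≅beyond (exs i)) (beyond≅forest (exs i))))
               (Σᴳ-forest≅forest (frontier ∘ exs) (λ _ → ↔-sym (∈-concatFin↔ k (frontier ∘ exs))))))))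

module Rewriting (G : FinGraph) where
  open Expansions (toGraph G) using (HasOutEdge)

  gen-self : ∀ v → gen G v v ≡ 1
  gen-self v with v ≟ v
  ... | yes _  = refl
  ... | no v≢v = ⊥-elim (v≢v refl)

  gen-other : ∀ {v u} → v ≢ u → gen G v u ≡ 0
  gen-other {v} {u} v≢u with v ≟ u
  ... | yes v≡u = ⊥-elim (v≢u v≡u)
  ... | no _    = refl

  record _⟶_ (x y : Vect G) : Set where
    constructor expand
    field
      vertex  : Fin (nV G)
      rest    : Vect G
      has-out : HasOutEdge vertex
      before  : ∀ u → x u ≡ gen G vertex u + rest u
      after   : ∀ u → y u ≡ outSum G vertex u + rest u

  infixr 5 _◅_
  data _⟶*_ : Vect G → Vect G → Set where
    done : ∀ {x y} → x ≗ y → x ⟶* y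
    _◅_  : ∀ {x y z} → x ⟶ y → y ⟶* z → x ⟶* z

  _⟶⁼_ : Vect G → Vect G → Set
  x ⟶⁼ y = x ≗ y ⊎ x ⟶ y

  ⟶-respˡ : ∀ {x′ x y} → x′ ≗ x → x ⟶ y → x′ ⟶ y
  ⟶-respˡ x′≗x (expand v r n before after) = expand v r n (λ u → trans (x′≗x u) (before u)) after

  ⟶*-respˡ : ∀ {x′ x y} → x′ ≗ x → x ⟶* y → x′ ⟶* y
  ⟶*-respˡ x′≗x (done x≗y) = done (λ u → trans (x′≗x u) (x≗y u))
  ⟶*-respˡ x′≗x (s ◅ ss)   = ⟶-respˡ x′≗x s ◅ ss

  ⟶*-trans : ∀ {x y z} → x ⟶* y → y ⟶* z → x ⟶* z
  ⟶*-trans (done x≗y) ts = ⟶*-respˡ x≗y ts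
  ⟶*-trans (s ◅ ss)   ts = s ◅ ⟶*-trans ss ts

  ⟶⁼⇒⟶* : ∀ {x y} → x ⟶⁼ y → x ⟶* y
  ⟶⁼⇒⟶* (inj₁ x≗y) = done x≗y
  ⟶⁼⇒⟶* (inj₂ s)   = s ◅ done (λ _ → refl)

  common-rest : ∀ {v w} {r s : Vect G} → v ≢ w → (∀ u → gen G v u + r u ≡ gen G w u + s u) →
                ∃ λ τ → (∀ u → r u ≡ gen G w u + τ u) × (∀ u → s u ≡ gen G v u + τ u)
  common-rest {v} {w} {r} {s} v≢w eq = (λ u → r u ∸ gen G w u) , r≡w+t , s≡v+t
    where
    w≤r : ∀ u → gen G w u ≤ r u
    w≤r u with w ≟ u
    ... | no _     = z≤n
    ... | yes refl = subst (1 ≤_) (begin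
      1 + s w             ≡⟨ cong (_+ s w) (gen-self w) ⟨
      gen G w w + s w     ≡⟨ eq w ⟨
      gen G v w + r w     ≡⟨ cong (_+ r w) (gen-other v≢w) ⟩
      r w                 ∎) (s≤s z≤n)
      where open ≡-Reasoning
    r≡w+t : ∀ u → r u ≡ gen G w u + (r u ∸ gen G w u)
    r≡w+t u = sym (m+[n∸m]≡n (w≤r u))
    s≡v+t : ∀ u → s u ≡ gen G v u + (r u ∸ gen G w u)
    s≡v+t u = +-cancelˡ-≡ (gen G w u) _ _ (begin
      gen G w u + s u                             ≡⟨ eq u ⟨
      gen G v u + r u                             ≡⟨ cong (gen G v u +_) (r≡w+t u) ⟩
      gen G v u + (gen G w u + (r u ∸ gen G w u)) ≡⟨ x∙yz≈y∙xz (gen G v u) (gen G w u) _ ⟩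
      gen G w u + (gen G v u + (r u ∸ gen G w u)) ∎)
      where open ≡-Reasoning

  diamond : ∀ {x a b} → x ⟶ a → x ⟶ b → ∃ λ c → a ⟶⁼ c × b ⟶⁼ c
  diamond {x} {a} {b} (expand v r nv xv av) (expand w s nw xw bw) with v ≟ w
  ... | yes refl = a , inj₁ (λ _ → refl) , inj₁ b≗a
    where
    b≗a : b ≗ a
    b≗a u = begin
      b u                 ≡⟨ bw u ⟩
      outSum G v u + s u  ≡⟨ cong (outSum G v u +_) (+-cancelˡ-≡ (gen G v u) _ _ (trans (sym (xw u)) (xv u))) ⟩
      outSum G v u + r u  ≡⟨ av u ⟨
      a u                 ∎
      where open ≡-Reasoning
  ... | no v≢w = c , inj₂ (expand w (λ u → outSum G v u + τ u) nw a-split (λ _ → refl))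
                   , inj₂ (expand v (λ u → outSum G w u + τ u) nv b-split
                                  (λ u → x∙yz≈y∙xz (outSum G w u) (outSum G v u) (τ u)))
    where
    common = common-rest v≢w (λ u → trans (sym (xv u)) (xw u))
    τ = proj₁ common
    c : Vect G
    c u = outSum G w u + (outSum G v u + τ u)
    a-split : ∀ u → a u ≡ gen G w u + (outSum G v u + τ u)
    a-split u = trans (av u) (trans (cong (outSum G v u +_) (proj₁ (proj₂ common) u))
                                    (x∙yz≈y∙xz (outSum G v u) (gen G w u) (τ u)))
    b-split : ∀ u → b u ≡ gen G v u + (outSum G w u + τ u)
    b-split u = trans (bw u) (trans (cong (outSum G w u +_) (proj₂ (proj₂ common) u))
                                    (x∙yz≈y∙xz (outSum G w u) (gen G v u) (τ u)))

  strip : ∀ {y a b} → y ⟶ a → y ⟶* b → ∃ λ c → a ⟶* c × b ⟶⁼ c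
  strip {a = a} s (done y≗b) = a , done (λ _ → refl) , inj₂ (⟶-respˡ (λ u → sym (y≗b u)) s)
  strip s (s₁ ◅ ss) with diamond s s₁
  ... | c₁ , a⟶c₁ , inj₁ b₁≗c₁ = _ , ⟶*-trans (⟶⁼⇒⟶* a⟶c₁) (⟶*-respˡ (λ u → sym (b₁≗c₁ u)) ss) , inj₁ (λ _ → refl)
  ... | c₁ , a⟶c₁ , inj₂ b₁⟶c₁ with strip b₁⟶c₁ ss
  ...   | c , c₁⟶*c , b⟶c = c , ⟶*-trans (⟶⁼⇒⟶* a⟶c₁) c₁⟶*c , b⟶c

  ⟶*-confluent : ∀ {y a b} → y ⟶* a → y ⟶* b → ∃ λ c → a ⟶* c × b ⟶* c
  ⟶*-confluent {b = b} (done y≗a) ss = b , ⟶*-respˡ (λ u → sym (y≗a u)) ss , done (λ _ → refl)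
  ⟶*-confluent (s ◅ ss) ts with strip s ts
  ... | c₁ , a₁⟶*c₁ , b⟶c₁ with ⟶*-confluent ss a₁⟶*c₁
  ...   | c , a⟶*c , c₁⟶*c = c , a⟶*c , ⟶*-trans (⟶⁼⇒⟶* b⟶c₁) c₁⟶*c

  ⟶*-⊕ : ∀ {x y} (z : Vect G) → x ⟶* y → _⊕_ {G} x z ⟶* _⊕_ {G} y z
  ⟶*-⊕ z (done x≗y) = done (λ u → cong (_+ z u) (x≗y u))
  ⟶*-⊕ z (expand v r n before after ◅ ss) =
    expand v (λ u → r u + z u) n (λ u → trans (cong (_+ z u) (before u)) (+-assoc (gen G v u) (r u) (z u)))
                                 (λ u → trans (cong (_+ z u) (after u)) (+-assoc (outSum G v u) (r u) (z u)))
    ◅ ⟶*-⊕ z ss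

  Joinable : Vect G → Vect G → Set
  Joinable x y = ∃ λ z → x ⟶* z × y ⟶* z

  MEq⇒joinable : ∀ {x y} → MEq G x y → Joinable x y
  MEq⇒joinable {x} (≈-ptw x≗y) = x , done (λ _ → refl) , done (λ u → sym (x≗y u))
  MEq⇒joinable (≈-sym m) with MEq⇒joinable m
  ... | z , x⟶*z , y⟶*z = z , y⟶*z , x⟶*z
  MEq⇒joinable (≈-trans m₁ m₂) with MEq⇒joinable m₁ | MEq⇒joinable m₂
  ... | _ , x⟶*z₁ , y⟶*z₁ | _ , y⟶*z₂ , z⟶*z₂ with ⟶*-confluent y⟶*z₁ y⟶*z₂
  ...   | c , z₁⟶*c , z₂⟶*c = c , ⟶*-trans x⟶*z₁ z₁⟶*c , ⟶*-trans z⟶*z₂ z₂⟶*c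
  MEq⇒joinable (≈-cong z m) with MEq⇒joinable m
  ... | _ , x⟶*c , y⟶*c = _ , ⟶*-⊕ z x⟶*c , ⟶*-⊕ z y⟶*c
  MEq⇒joinable (≈-rel v n) =
    outSum G v , expand v (λ _ → 0) n (λ _ → sym (+-identityʳ _)) (λ _ → sym (+-identityʳ _)) ◅ done (λ _ → refl)
               , done (λ _ → refl)

update : ∀ {n} {P : Fin n → Set} → ((j : Fin n) → P j) → (i : Fin n) → P i → (j : Fin n) → P j
update f i x j with i ≟ j
... | yes refl = x
... | no _     = f j

update-same : ∀ {n} {P : Fin n → Set} (f : (j : Fin n) → P j) i x → update f i x i ≡ x
update-same f i x with i ≟ i
... | yes refl = refl
... | no i≢i   = ⊥-elim (i≢i refl)

update-other : ∀ {n} {P : Fin n → Set} (f : (j : Fin n) → P j) i x {j} → j ≢ i → update f i x j ≡ f j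
update-other f i x {j} j≢i with i ≟ j
... | yes refl = ⊥-elim (j≢i refl)
... | no _     = refl

sumFin : ∀ n → (Fin n → ℕ) → ℕ
sumFin zero    g = 0
sumFin (suc n) g = g zero + sumFin n (g ∘ suc)

sumFin-cong : ∀ n {g h : Fin n → ℕ} → g ≗ h → sumFin n g ≡ sumFin n h
sumFin-cong zero    g≗h = refl
sumFin-cong (suc n) g≗h = cong₂ _+_ (g≗h zero) (sumFin-cong n (g≗h ∘ suc))

sum-map-allFin : ∀ n (g : Fin n → ℕ) → sum (map g (allFin n)) ≡ sumFin n g
sum-map-allFin zero    g = refl
sum-map-allFin (suc n) g =
  cong (g zero +_) (trans (cong sum (trans (map-tabulate suc g) (sym (map-tabulate id (g ∘ suc)))))
                          (sum-map-allFin n (g ∘ suc)))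

sumFin-update : ∀ n {g h : Fin n → ℕ} i {c d} → (∀ {j} → j ≢ i → g j ≡ h j) → g i + c ≡ h i + d →
                sumFin n g + c ≡ sumFin n h + d
sumFin-update (suc n) {g} {h} zero {c} {d} others changed = begin
  g zero + S + c       ≡⟨ +-assoc (g zero) S c ⟩
  g zero + (S + c)     ≡⟨ cong (g zero +_) (+-comm S c) ⟩
  g zero + (c + S)     ≡⟨ +-assoc (g zero) c S ⟨
  g zero + c + S       ≡⟨ cong (_+ S) changed ⟩
  h zero + d + S       ≡⟨ +-assoc (h zero) d S ⟩
  h zero + (d + S)     ≡⟨ cong (h zero +_) (cong (d +_) (sumFin-cong n (λ j → others (λ ())))) ⟩
  h zero + (d + S′)    ≡⟨ cong (h zero +_) (+-comm d S′) ⟩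
  h zero + (S′ + d)    ≡⟨ +-assoc (h zero) S′ d ⟨
  h zero + S′ + d      ∎
  where
  open ≡-Reasoning
  S  = sumFin n (g ∘ suc)
  S′ = sumFin n (h ∘ suc)
sumFin-update (suc n) {g} {h} (suc i) {c} {d} others changed = begin
  g zero + sumFin n (g ∘ suc) + c     ≡⟨ +-assoc (g zero) _ c ⟩
  g zero + (sumFin n (g ∘ suc) + c)   ≡⟨ cong₂ _+_ (others (λ ()))
                                                   (sumFin-update n i (others ∘ (_∘ suc-injective)) changed) ⟩
  h zero + (sumFin n (h ∘ suc) + d)   ≡⟨ +-assoc (h zero) _ d ⟨
  h zero + sumFin n (h ∘ suc) + d     ∎
  where open ≡-Reasoning

module Counting (G : FinGraph) where
  open Frontier G
  open Rewriting G

  toVect : List (Fin (nV G)) → Vect G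
  toVect []      u = 0
  toVect (a ∷ L) u = gen G a u + toVect L u

  toVect-++ : ∀ xs ys u → toVect (xs ++ ys) u ≡ toVect xs u + toVect ys u
  toVect-++ []       ys u = refl
  toVect-++ (x ∷ xs) ys u = trans (cong (gen G x u +_) (toVect-++ xs ys u)) (sym (+-assoc (gen G x u) _ _))

  toVect-concatFin : ∀ n (h : Fin n → List (Fin (nV G))) u →
                     toVect (concatFin n h) u ≡ sumFin n (λ i → toVect (h i) u)
  toVect-concatFin zero    h u = refl
  toVect-concatFin (suc n) h u =
    trans (toVect-++ (h zero) _ u) (cong (toVect (h zero) u +_) (toVect-concatFin n (h ∘ suc) u))

  toVect-concatFin-update : ∀ {n} {P : Fin n → Set} (F : (j : Fin n) → P j → List (Fin (nV G)))
    (f : (j : Fin n) → P j) i x {c d : Vect G} →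
    (∀ u → toVect (F i x) u + c u ≡ toVect (F i (f i)) u + d u) →
    ∀ u → toVect (concatFin n (λ j → F j (update f i x j))) u + c u ≡ toVect (concatFin n (λ j → F j (f j))) u + d u
  toVect-concatFin-update {n} F f i x changed u =
    trans (cong (_+ _) (toVect-concatFin n _ u))
      (trans (sumFin-update n i (λ {j} j≢i → cong (λ y → toVect (F j y) u) (update-other f i x j≢i))
                               (trans (cong (λ y → toVect (F i y) u + _) (update-same f i x)) (changed u)))
             (cong (_+ _) (sym (toVect-concatFin n _ u))))

  outSum≡toVect-targets : ∀ a u → outSum G a u ≡ toVect (concatFin (nE G) (λ e → guard (src G e ≟ a) (tgt G e ∷ []))) u
  outSum≡toVect-targets a u =
    trans (sum-map-allFin (nE G) _) (trans (sumFin-cong (nE G) count-edge) (sym (toVect-concatFin (nE G) _ u)))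
    where
    count-edge : ∀ e → (if ⌊ src G e ≟ a ⌋ ∧ ⌊ tgt G e ≟ u ⌋ then 1 else 0) ≡
                       toVect (guard (src G e ≟ a) (tgt G e ∷ [])) u
    count-edge e with src G e ≟ a
    ... | yes _ = sym (+-identityʳ _)
    ... | no _  = refl

  expandFrontier : ∀ {a v} (ex : Expansion a) → v ∈ frontier ex → HasOutEdge v → Expansion a
  expandFrontier leaf       (here refl) out = node out (λ _ → leaf)
  expandFrontier (node n f) m           out =
    let (e , _) , m′ = Inverse.from (∈-frontier-node↔ n f) m
    in  node n (update f e (expandFrontier (f e) m′ out))

  toVect-expandFrontier : ∀ {a v} (ex : Expansion a) (m : v ∈ frontier ex) (out : HasOutEdge v) u →
    toVect (frontier (expandFrontier ex m out)) u + gen G v u ≡ toVect (frontier ex) u + outSum G v u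
  toVect-expandFrontier {a} leaf (here refl) out u = begin
    toVect (frontier (node out (λ _ → leaf))) u + gen G a u ≡⟨ +-comm _ (gen G a u) ⟩
    gen G a u + toVect (frontier (node out (λ _ → leaf))) u ≡⟨ cong (gen G a u +_) (outSum≡toVect-targets a u) ⟨
    gen G a u + outSum G a u                               ≡⟨ cong (_+ outSum G a u) (+-identityʳ (gen G a u)) ⟨
    gen G a u + 0 + outSum G a u                           ∎
    where open ≡-Reasoning
  toVect-expandFrontier {a} {v} (node n f) m out u =
    let (e , src≡a) , m′ = Inverse.from (∈-frontier-node↔ n f) m
        guarded : ∀ ex u → toVect (guard (src G e ≟ a) (frontier ex)) u ≡ toVect (frontier ex) u
        guarded ex u = cong (λ L → toVect L u) (guard-yes src≡a (src G e ≟ a) (frontier ex))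
    in  toVect-concatFin-update (λ e ex → guard (src G e ≟ a) (frontier ex)) f e (expandFrontier (f e) m′ out)
          (λ u → trans (cong (_+ gen G v u) (guarded (expandFrontier (f e) m′ out) u))
                   (trans (toVect-expandFrontier (f e) m′ out u) (cong (_+ outSum G v u) (sym (guarded (f e) u)))))
          u

  ∈-toVect : ∀ L v → 1 ≤ toVect L v → v ∈ L
  ∈-toVect (a ∷ L) v pos with a ≟ v
  ... | yes a≡v = here (sym a≡v)
  ... | no _    = there (∈-toVect L v pos)

  toVect-pos : ∀ {x : Vect G} {v r} L → toVect L ≗ x → x v ≡ gen G v v + r → v ∈ L
  toVect-pos {x} {v} {r} L L≗x xv = ∈-toVect L v (subst (1 ≤_) (sym (begin
    toVect L v     ≡⟨ L≗x v ⟩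
    x v            ≡⟨ xv ⟩
    gen G v v + r  ≡⟨ cong (_+ r) (gen-self v) ⟩
    1 + r          ∎)) (s≤s z≤n))
    where open ≡-Reasoning

  module _ {k} {ρ : Fin k → Fin (nV G)} where

    expandFrontiers : ∀ {v} (exs : (i : Fin k) → Expansion (ρ i)) → v ∈ frontiers exs → HasOutEdge v →
                      (i : Fin k) → Expansion (ρ i)
    expandFrontiers exs m out =
      let i , m′ = Inverse.to (∈-concatFin↔ k (frontier ∘ exs)) m
      in  update exs i (expandFrontier (exs i) m′ out)

    toVect-expandFrontiers : ∀ {v} exs (m : v ∈ frontiers exs) (out : HasOutEdge v) u →
      toVect (frontiers (expandFrontiers exs m out)) u + gen G v u ≡ toVect (frontiers exs) u + outSum G v u
    toVect-expandFrontiers exs m out =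
      let i , m′ = Inverse.to (∈-concatFin↔ k (frontier ∘ exs)) m
      in  toVect-concatFin-update (λ _ → frontier) exs i _ (toVect-expandFrontier (exs i) m′ out)

    realise : ∀ {x z} exs → toVect (frontiers exs) ≗ x → x ⟶* z → ∃ λ exs′ → toVect (frontiers exs′) ≗ z
    realise exs L≗x (done x≗z) = exs , λ u → trans (L≗x u) (x≗z u)
    realise {x} exs L≗x (_◅_ {y = y} (expand v r out before after) ss) = realise exs′ L′≗y ss
      where
      m = toVect-pos (frontiers exs) L≗x (before v)
      exs′ = expandFrontiers exs m out
      L′≗y : toVect (frontiers exs′) ≗ y
      L′≗y u = +-cancelˡ-≡ (gen G v u) _ _ (begin
        gen G v u + toVect (frontiers exs′) u     ≡⟨ +-comm (gen G v u) _ ⟩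
        toVect (frontiers exs′) u + gen G v u     ≡⟨ toVect-expandFrontiers exs m out u ⟩
        toVect (frontiers exs) u + outSum G v u   ≡⟨ cong (_+ outSum G v u) (trans (L≗x u) (before u)) ⟩
        gen G v u + r u + outSum G v u            ≡⟨ +-assoc (gen G v u) (r u) _ ⟩
        gen G v u + (r u + outSum G v u)          ≡⟨ cong (gen G v u +_) (trans (+-comm (r u) _) (sym (after u))) ⟩
        gen G v u + y u                           ∎)
        where open ≡-Reasoning

    toVect-frontiers-leaves : toVect (frontiers {ρ = ρ} (λ _ → leaf)) ≗ sumMap G ρ
    toVect-frontiers-leaves u =
      trans (toVect-concatFin k _ u) (trans (sumFin-cong k (λ _ → +-identityʳ _)) (sym (sum-map-allFin k _)))

    sumMap-realise : ∀ {z} → sumMap G ρ ⟶* z → ∃ λ exs → toVect (frontiers {ρ = ρ} exs) ≗ z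
    sumMap-realise = realise (λ _ → leaf) toVect-frontiers-leaves

  toVect-≗⇒↭ : ∀ L₁ L₂ → toVect L₁ ≗ toVect L₂ → L₁ ↭ L₂
  toVect-≗⇒↭ [] [] _ = ↭-refl
  toVect-≗⇒↭ [] (b ∷ L₂) eq with trans (eq b) (cong (_+ toVect L₂ b) (gen-self b))
  ... | ()
  toVect-≗⇒↭ (a ∷ L₁) L₂ eq with ∈-∃++ (toVect-pos {v = a} {r = toVect L₁ a} L₂ (λ u → sym (eq u)) refl)
  ... | xs , ys , refl = ↭-trans (↭-prep a (toVect-≗⇒↭ L₁ (xs ++ ys) L₁≗)) (↭-sym (shift a xs ys))
    where
    L₁≗ : toVect L₁ ≗ toVect (xs ++ ys)
    L₁≗ u = +-cancelˡ-≡ (gen G a u) _ _ (begin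
      gen G a u + toVect L₁ u                ≡⟨ eq u ⟩
      toVect (xs ++ a ∷ ys) u                ≡⟨ toVect-++ xs (a ∷ ys) u ⟩
      toVect xs u + (gen G a u + toVect ys u) ≡⟨ x∙yz≈y∙xz (toVect xs u) (gen G a u) _ ⟩
      gen G a u + (toVect xs u + toVect ys u) ≡⟨ cong (gen G a u +_) (toVect-++ xs ys u) ⟨
      gen G a u + toVect (xs ++ ys) u        ∎)
      where open ≡-Reasoning

Σ-irrelevant-≡ : ∀ {A : Set} {P : A → Set} {a b : A} .{p : P a} .{q : P b} →
                 a ≡ b → _≡_ {A = Σ A (Irrelevant ∘ P)} (a , [ p ]) (b , [ q ])
Σ-irrelevant-≡ refl = refl

-- The graph Γ ∖ H; an edge outside H makes both its ends non-removed.
Complement : ∀ {Γ} → Subgraph Γ → Graph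
Complement {Γ} H = record
  { V = Σ (V Γ) (Irrelevant ∘ RemV H)
  ; E = Σ (E Γ) (Irrelevant ∘ RemE H)
  ; o = λ (e , [ e∉H ]) → o Γ e , [ (λ (_ , _ , all∈H) → e∉H (all∈H e (inj₁ refl))) ]
  ; t = λ (e , [ e∉H ]) → t Γ e , [ (λ (_ , _ , all∈H) → e∉H (all∈H e (inj₂ refl))) ]
  }

≅⇒IsoMinus : ∀ {Γ₁ Γ₂} {H₁ : Subgraph Γ₁} {H₂ : Subgraph Γ₂} → Complement H₁ ≅ Complement H₂ → IsoMinus H₁ H₂
≅⇒IsoMinus φ = record
  { fV     = λ v p → proj₁ (vertex (v , [ p ]))
  ; gV     = λ v p → proj₁ (vertex⁻¹ (v , [ p ]))
  ; fE     = λ e p → proj₁ (edge (e , [ p ]))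
  ; gE     = λ e p → proj₁ (edge⁻¹ (e , [ p ]))
  ; fV-rem = λ v p → relevant (proj₂ (vertex (v , [ p ])))
  ; gV-rem = λ v p → relevant (proj₂ (vertex⁻¹ (v , [ p ])))
  ; fE-rem = λ e p → relevant (proj₂ (edge (e , [ p ])))
  ; gE-rem = λ e p → relevant (proj₂ (edge⁻¹ (e , [ p ])))
  ; gfV    = λ v p → cong proj₁ (Inverse.strictlyInverseʳ vertices (v , [ p ]))
  ; fgV    = λ v p → cong proj₁ (Inverse.strictlyInverseˡ vertices (v , [ p ]))
  ; gfE    = λ e p → cong proj₁ (Inverse.strictlyInverseʳ edges (e , [ p ]))
  ; fgE    = λ e p → cong proj₁ (Inverse.strictlyInverseˡ edges (e , [ p ]))
  ; o-comm = λ e p _ → cong proj₁ (o-comm (e , [ p ]))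
  ; t-comm = λ e p _ → cong proj₁ (t-comm (e , [ p ]))
  }
  where
  open _≅_ φ
  relevant : ∀ {A : Set} → Irrelevant (¬ A) → ¬ A
  relevant [ ¬a ] a = Irr.⊥-elim (¬a a)

≅-complements⇒almostIsomorphic : ∀ {Γ₁ Γ₂} (T₁ : Subgraph Γ₁) (T₂ : Subgraph Γ₂) →
  FiniteSub T₁ × IsTreeSub T₁ → FiniteSub T₂ × IsTreeSub T₂ →
  Complement T₁ ≅ Complement T₂ → AlmostIsomorphic Γ₁ Γ₂
≅-complements⇒almostIsomorphic T₁ T₂ T₁-finite-tree T₂-finite-tree φ =
  T₁ , T₂ , T₁-finite-tree , T₂-finite-tree , ≅⇒IsoMinus φ

module UnfoldingTree (Γ : Graph) (_≟ⱽ_ : DecidableEquality (V Γ))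
                     (edges : List (E Γ)) (∈-edges : ∀ e → e ∈ edges) (S : V Γ) where
  open Expansions Γ

  U : Graph
  U = Unfolding Γ S

  _++ᵂ_ : ∀ {x a y} → Walk Γ x a → Walk Γ a y → Walk Γ x y
  ε       ++ᵂ w = w
  (e ∷ u) ++ᵂ w = e ∷ (u ++ᵂ w)

  ++ᵂ-identityʳ : ∀ {x y} (u : Walk Γ x y) → u ++ᵂ ε ≡ u
  ++ᵂ-identityʳ ε       = refl
  ++ᵂ-identityʳ (e ∷ u) = cong (e ∷_) (++ᵂ-identityʳ u)

  snoc-++ᵂ : ∀ {x y} e (u : Walk Γ x (o Γ e)) (w : Walk Γ (t Γ e) y) → snoc e u ++ᵂ w ≡ u ++ᵂ (e ∷ w)
  snoc-++ᵂ e ε        w = refl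
  snoc-++ᵂ e (e′ ∷ u) w = cong (e′ ∷_) (snoc-++ᵂ e u w)

  toWalk : ∀ {y} → PathFrom Γ S y → Walk Γ S y
  toWalk ε       = ε
  toWalk (e ▷ p) = snoc e (toWalk p)

  extend : ∀ {a y} → PathFrom Γ S a → Walk Γ a y → PathFrom Γ S y
  extend p ε       = p
  extend p (e ∷ w) = extend (e ▷ p) w

  fromWalk : ∀ {y} → Walk Γ S y → PathFrom Γ S y
  fromWalk = extend ε

  toWalk-extend : ∀ {a y} (p : PathFrom Γ S a) (w : Walk Γ a y) → toWalk (extend p w) ≡ toWalk p ++ᵂ w
  toWalk-extend p ε       = sym (++ᵂ-identityʳ (toWalk p))
  toWalk-extend p (e ∷ w) = trans (toWalk-extend (e ▷ p) w) (snoc-++ᵂ e (toWalk p) w)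

  toWalk∘fromWalk : ∀ {y} (w : Walk Γ S y) → toWalk (fromWalk w) ≡ w
  toWalk∘fromWalk = toWalk-extend ε

  extend-snoc : ∀ {a} e (p : PathFrom Γ S a) (w : Walk Γ a (o Γ e)) → extend p (snoc e w) ≡ e ▷ extend p w
  extend-snoc e p ε        = refl
  extend-snoc e p (e′ ∷ w) = extend-snoc e (e′ ▷ p) w

  fromWalk∘toWalk : ∀ {y} (p : PathFrom Γ S y) → fromWalk (toWalk p) ≡ p
  fromWalk∘toWalk ε       = refl
  fromWalk∘toWalk (e ▷ p) = trans (extend-snoc e ε (toWalk p)) (cong (e ▷_) (fromWalk∘toWalk p))

  pathLength : ∀ {y} → PathFrom Γ S y → ℕ
  pathLength ε       = 0
  pathLength (e ▷ p) = suc (pathLength p)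

  walkLength : ∀ {x y} → Walk Γ x y → ℕ
  walkLength ε       = 0
  walkLength (e ∷ w) = suc (walkLength w)

  walkLength-snoc : ∀ {x} e (w : Walk Γ x (o Γ e)) → walkLength (snoc e w) ≡ suc (walkLength w)
  walkLength-snoc e ε        = refl
  walkLength-snoc e (e′ ∷ w) = cong suc (walkLength-snoc e w)

  walkLength-toWalk : ∀ {y} (p : PathFrom Γ S y) → walkLength (toWalk p) ≡ pathLength p
  walkLength-toWalk ε       = refl
  walkLength-toWalk (e ▷ p) = trans (walkLength-snoc e (toWalk p)) (cong suc (walkLength-toWalk p))

  depth : ∀ {x} → Expansion x → ℕ
  depth leaf       = 0
  depth (node _ f) = suc (max 0 (map (λ e → depth (f e)) edges))

  interior-walkLength : ∀ {x y} (ex : Expansion x) (w : Walk Γ x y) → interior ex w ≡ true → walkLength w ≤ depth ex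
  interior-walkLength (node _ f) ε       _ = z≤n
  interior-walkLength (node _ f) (e ∷ w) i =
    s≤s (≤-trans (interior-walkLength (f e) w i)
                 (All.lookup (xs≤max 0 (map (λ e → depth (f e)) edges)) (∈-map⁺ (λ e → depth (f e)) (∈-edges e))))

  interior-pathLength : ∀ {y} (ex : Expansion S) (p : PathFrom Γ S y) →
                        interior ex (toWalk p) ≡ true → pathLength p ≤ depth ex
  interior-pathLength ex p i = subst (_≤ depth ex) (walkLength-toWalk p) (interior-walkLength ex (toWalk p) i)

  extension : ∀ y → PathFrom Γ S y → E Γ → List (V U)
  extension y p e with o Γ e ≟ⱽ y
  ... | yes refl = (t Γ e , e ▷ p) ∷ []
  ... | no _     = []

  edgeAt : ∀ y → PathFrom Γ S y → E Γ → List (E U)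
  edgeAt y p e with o Γ e ≟ⱽ y
  ... | yes refl = (e , p) ∷ []
  ... | no _     = []

  ∈-extension : ∀ e (p : PathFrom Γ S (o Γ e)) → (t Γ e , e ▷ p) ∈ extension (o Γ e) p e
  ∈-extension e p with o Γ e ≟ⱽ o Γ e
  ... | yes refl = here refl
  ... | no o≢o   = ⊥-elim (o≢o refl)

  ∈-edgeAt : ∀ e (p : PathFrom Γ S (o Γ e)) → (e , p) ∈ edgeAt (o Γ e) p e
  ∈-edgeAt e p with o Γ e ≟ⱽ o Γ e
  ... | yes refl = here refl
  ... | no o≢o   = ⊥-elim (o≢o refl)

  vertices≤ : ℕ → List (V U)
  vertices≤ zero    = (S , ε) ∷ []
  vertices≤ (suc N) = (S , ε) ∷ concatMap (λ (y , p) → concatMap (extension y p) edges) (vertices≤ N)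

  edges≤ : ℕ → List (E U)
  edges≤ N = concatMap (λ (y , p) → concatMap (edgeAt y p) edges) (vertices≤ N)

  ∈-vertices≤ : ∀ N {y} (p : PathFrom Γ S y) → pathLength p ≤ N → (y , p) ∈ vertices≤ N
  ∈-vertices≤ zero    ε       _        = here refl
  ∈-vertices≤ (suc N) ε       _        = here refl
  ∈-vertices≤ (suc N) (e ▷ p) (s≤s ≤N) =
    there (∈-concatMap⁺ _ (lose (∈-vertices≤ N p ≤N) (∈-concatMap⁺ _ (lose (∈-edges e) (∈-extension e p)))))

  ∈-edges≤ : ∀ N e (p : PathFrom Γ S (o Γ e)) → pathLength p ≤ N → (e , p) ∈ edges≤ N
  ∈-edges≤ N e p ≤N = ∈-concatMap⁺ _ (lose (∈-vertices≤ N p ≤N) (∈-concatMap⁺ _ (lose (∈-edges e) (∈-edgeAt e p))))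

  module ExpansionTree (n : HasOutEdge S) (f : (e : E Γ) → Expansion (t Γ e)) where

    private
      ex : Expansion S
      ex = node n f

    inner : ∀ {y} → PathFrom Γ S y → Bool
    inner p = interior ex (toWalk p)

    ParentInner : ∀ {y} → PathFrom Γ S y → Set
    ParentInner ε       = ⊥
    ParentInner (e ▷ p) = inner p ≡ true

    tree : Subgraph U
    tree = record
      { VP     = λ (_ , p) → inner p ≡ true ⊎ ParentInner p
      ; EP     = λ (_ , p) → inner p ≡ true
      ; closed = λ _ i → inj₁ i , inj₂ i
      }

    tree-finite : FiniteSub tree
    tree-finite = (vertices≤ (suc (depth ex)) , λ (_ , p) p∈T → ∈-vertices≤ _ p (length≤ p p∈T))
                , (edges≤ (depth ex) , λ (e , p) i → ∈-edges≤ _ e p (interior-pathLength ex p i))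
      where
      length≤ : ∀ {y} (p : PathFrom Γ S y) → VP tree (y , p) → pathLength p ≤ suc (depth ex)
      length≤ p       (inj₁ i) = m≤n⇒m≤1+n (interior-pathLength ex p i)
      length≤ (e ▷ p) (inj₂ i) = s≤s (interior-pathLength ex p i)

    height : V U → ℕ
    height (_ , p) = pathLength p

    subWalk-height : ∀ {a b} → SubWalk tree a b → height a ≤ height b
    subWalk-height ε           = ≤-refl
    subWalk-height (_∷_ _ _ w) = ≤-trans (n≤1+n _) (subWalk-height w)

    subWalk-snoc : ∀ {a} (e : E U) → SubWalk tree a (o U e) → EP tree e → SubWalk tree a (t U e)
    subWalk-snoc e ε              e∈T = _∷_ e e∈T ε
    subWalk-snoc e (_∷_ e′ e′∈T w) e∈T = _∷_ e′ e′∈T (subWalk-snoc e w e∈T)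

    inner-from-root : ∀ {y} (p : PathFrom Γ S y) → inner p ≡ true → SubWalk tree (S , ε) (y , p)
    inner-from-root ε       _ = ε
    inner-from-root (e ▷ p) i = subWalk-snoc (e , p) (inner-from-root p i′) i′
      where i′ = interior-prefix ex e (toWalk p) i

    from-root : ∀ v → VP tree v → SubWalk tree (S , ε) v
    from-root (_ , p)     (inj₁ i) = inner-from-root p i
    from-root (_ , e ▷ p) (inj₂ i) = subWalk-snoc (e , p) (inner-from-root p i) i

    lastEdge : V U → Maybe (E U)
    lastEdge (_ , ε)     = nothing
    lastEdge (_ , e ▷ p) = just (e , p)

    tree-isTree : IsTreeSub tree
    tree-isTree = (λ x y x∈T y∈T → (S , ε) , inj₁ refl , from-root x x∈T , from-root y y∈T)
                , (λ e _ cycle → 1+n≰n (subWalk-height cycle))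
                , (λ e e′ _ _ t≡t → just-injective (cong lastEdge t≡t))

    Removed⇒removed : ∀ {y} (p : PathFrom Γ S y) → Removed tree (y , p) → removed ex (toWalk p) ≡ true
    Removed⇒removed p ((out , o≡) , ((e , q) , t≡) , incident∈T) = begin
      removed ex (toWalk p)                ≡⟨ cong (λ (_ , p) → removed ex (toWalk p)) t≡ ⟨
      removed ex (snoc e (toWalk q))       ≡⟨ removed-snoc ex e (toWalk q) ⟩
      interior ex (snoc e (toWalk q))      ≡⟨ cong (λ (_ , p) → inner p) t≡ ⟩
      inner p                              ≡⟨ cong (λ (_ , p) → inner p) o≡ ⟨
      inner (proj₂ out)                    ≡⟨ incident∈T out (inj₁ o≡) ⟩
      true                                 ∎
      where open ≡-Reasoning

    removed⇒Removed : ∀ {y} (p : PathFrom Γ S y) → removed ex (toWalk p) ≡ true → Removed tree (y , p)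
    removed⇒Removed (e ▷ q) r = outEdge (e ▷ q) (proj₂ has-out) , ((e , q) , refl) , incident∈T
      where
      i : inner (e ▷ q) ≡ true
      i = trans (sym (removed-snoc ex e (toWalk q))) r
      has-out = interior⇒hasOutEdge ex (toWalk (e ▷ q)) i
      outEdge : ∀ {e′ y} (p : PathFrom Γ S y) → o Γ e′ ≡ y → Σ (E U) (λ ε′ → o U ε′ ≡ (y , p))
      outEdge {e′} p refl = (e′ , p) , refl
      incident∈T : ∀ ε′ → o U ε′ ≡ (t Γ e , e ▷ q) ⊎ t U ε′ ≡ (t Γ e , e ▷ q) → EP tree ε′
      incident∈T ε′        (inj₁ o≡) = subst (λ (_ , p) → inner p ≡ true) (sym o≡) i
      incident∈T (e′ , q′) (inj₂ t≡) = interior-prefix ex e′ (toWalk q′) (subst (λ (_ , p) → inner p ≡ true) (sym t≡) i)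

    ¬Removed⇒¬removed : ∀ {y} (p : PathFrom Γ S y) → RemV tree (y , p) → removed ex (toWalk p) ≡ false
    ¬Removed⇒¬removed p ¬R = ¬-not (¬R ∘ removed⇒Removed p)

    ¬removed⇒¬Removed : ∀ {y} (w : Walk Γ S y) → removed ex w ≡ false → RemV tree (y , fromWalk w)
    ¬removed⇒¬Removed w ¬r R = true≢false (begin
      true                             ≡⟨ Removed⇒removed (fromWalk w) R ⟨
      removed ex (toWalk (fromWalk w)) ≡⟨ cong (removed ex) (toWalk∘fromWalk w) ⟩
      removed ex w                     ≡⟨ ¬r ⟩
      false                            ∎)
      where open ≡-Reasoning

    complement≅coneMinus : Complement tree ≅ ConeMinus ex
    complement≅coneMinus = record
      { vertices = mk↔ₛ′ (λ ((y , p) , [ ¬R ]) → y , toWalk p , [ ¬Removed⇒¬removed p ¬R ])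
                         (λ (y , w , [ ¬r ]) → (y , fromWalk w) , [ ¬removed⇒¬Removed w ¬r ])
                         (λ (y , w , _) → cong (y ,_) (Σ-irrelevant-≡ (toWalk∘fromWalk w)))
                         (λ ((y , p) , _) → Σ-irrelevant-≡ (cong (y ,_) (fromWalk∘toWalk p)))
      ; edges    = mk↔ₛ′ (λ ((e , p) , [ e∉T ]) → e , toWalk p , [ ¬-not e∉T ])
                         (λ (e , w , [ ¬i ]) → (e , fromWalk w) ,
                            [ (λ i → true≢false (trans (sym i) (trans (cong (interior ex) (toWalk∘fromWalk w)) ¬i))) ])
                         (λ (e , w , _) → cong (e ,_) (Σ-irrelevant-≡ (toWalk∘fromWalk w)))
                         (λ ((e , p) , _) → Σ-irrelevant-≡ (cong (e ,_) (fromWalk∘toWalk p)))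
      ; o-comm   = λ _ → refl
      ; t-comm   = λ _ → refl
      }

spiderEdges : (G : FinGraph) (k : ℕ) → List (Fin k ⊎ Fin (nE G))
spiderEdges G k = map inj₁ (allFin k) ++ map inj₂ (allFin (nE G))

∈-spiderEdges : ∀ G k e → e ∈ spiderEdges G k
∈-spiderEdges G k (inj₁ i) = ∈-++⁺ˡ (∈-map⁺ inj₁ (∈-allFin i))
∈-spiderEdges G k (inj₂ e) = ∈-++⁺ʳ (map inj₁ (allFin k)) (∈-map⁺ inj₂ (∈-allFin e))

spiderUnfolding-minus-tree : (G : FinGraph) {k : ℕ} (ρ : Fin k → Fin (nV G)) → Fin k →
  (exs : (i : Fin k) → Frontier.Expansion G (ρ i)) →
  Σ (Subgraph (Unfolding (Spider G k ρ) (root G k ρ))) λ T →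
    (FiniteSub T × IsTreeSub T) × (Complement T ≅ point ⊞ Frontier.Forest G (Frontier.frontiers G exs))
spiderUnfolding-minus-tree G {k} ρ i₀ exs =
  tree , (tree-finite , tree-isTree) ,
  ≅-trans complement≅coneMinus (SpiderCones.coneMinus-root≅point⊞forest G ρ i₀ exs)
  where
  open UnfoldingTree (Spider G k ρ) (≡-dec Unit._≟_ _≟_) (spiderEdges G k) (∈-spiderEdges G k) (root G k ρ)
  open ExpansionTree (inj₁ i₀ , refl) (SpiderCones.rootChildren G ρ exs)

lemma16 : (G : FinGraph) → NonRedundant (toGraph G) →
    (k l : ℕ) → 0 < k → 0 < l →
    (ρ : Fin k → Fin (nV G)) (σ : Fin l → Fin (nV G)) →
    CoversG G ρ → CoversG G σ →
    MEq G (sumMap G ρ) (sumMap G σ) →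
    AlmostIsomorphic (Unfolding (Spider G k ρ) (root G k ρ))
                     (Unfolding (Spider G l σ) (root G l σ))
lemma16 G _ (suc k) (suc l) _ _ ρ σ _ _ ρ≈σ =
  let z , ρ⟶*z , σ⟶*z = MEq⇒joinable ρ≈σ
      exsρ , frontiersρ≗z = sumMap-realise ρ⟶*z
      exsσ , frontiersσ≗z = sumMap-realise σ⟶*z
      Tρ , Tρ-finite-tree , Tρ-complement = spiderUnfolding-minus-tree G ρ zero exsρ
      Tσ , Tσ-finite-tree , Tσ-complement = spiderUnfolding-minus-tree G σ zero exsσ
      frontiers↭ = toVect-≗⇒↭ (frontiers exsρ) (frontiers exsσ)
                              (λ u → trans (frontiersρ≗z u) (sym (frontiersσ≗z u)))
  in  ≅-complements⇒almostIsomorphic Tρ Tσ Tρ-finite-tree Tσ-finite-tree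
        (≅-trans Tρ-complement (≅-trans (⊞-congʳ (↭⇒forest≅ frontiers↭)) (≅-sym Tσ-complement)))
  where
  open Frontier G
  open Rewriting G
  open Counting G
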